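{- With the binary tree $T$, the constant $\beta=1/(8\alpha_G)$ and the vectors $d_i$ defined in the context, for every node $j\in I_T$, \[\sum_{i\in I_T}|d_i(S_j)|\ \le\ 8\beta k=k/\alpha_G.\]
   Context: $G=(V,E)$ is a $d$-regular graph on $n$ vertices with edge-connectivity $k\ge1$. A hierarchical decomposition of $V$ is a rooted tree whose nodes $i$ correspond to subsets $S_i\subseteq V$, the root corresponding to $V$, the sets of the children of a node partitioning the set of that node, and the leaves being the singletons $\{v\}$. $R$ is a Räcke decomposition of $G$ with congestion ratio $\alpha_G\ge1$; in particular $R$ is a hierarchical decomposition that is well-balanced: $|S_j|\le\frac34|S_i|$ for every child $j$ of every node $i$. $T$ is the binary hierarchical decomposition obtained from $R$ by repeatedly applying the following step until every non-leaf node has two children: choose a node $i$ with $p>2$ children $j_1,\dots,j_p$, $w(h)=|S_{j_h}|/|S_i|$; (a) if $w(h)>1/4$ for some $h$, make $j_h$ one child of $i$ and create a new child $b$ with $S_b=S_i\setminus S_{j_h}$ whose children are the other $p-1$ nodes; (b) otherwise partition the children into $A,B$ with total weights in $[1/4,3/4]$ and create two new children $a,b$ of $i$ with $S_a=\bigcup_{j\in A}S_j$, $S_b=\bigcup_{j\in B}S_j$ and children $A$, $B$ respectively. $I_T$ denotes the internal nodes of $T$; $\ell(i),r(i)$ the left and right children of $i\in I_T$. For $i\in I_T$, $d_i:V\to\mathbb{R}$ is given by $d_i(u)=-\beta k/|S_{\ell(i)}|$ for $u\in S_{\ell(i)}$, $d_i(v)=\beta k/|S_{r(i)}|$ for $v\in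 S_{r(i)}$, $d_i(w)=0$ for $w\notin S_i$; and $d_i(W)=\sum_{w\in W}d_i(w)$ for $W\subseteq V$.
   Formalization: The congestion ratio α_G and the constant β are taken in the rationals. -}

module Defs where

open import Data.Nat using (ℕ; zero; suc; _≤_; _<_; _*_)
open import Data.Integer using (+_)
open import Data.Fin using (Fin)
open import Data.Fin.Properties using (_≟_)
open import Data.List using (List; []; _∷_; _++_; length; allFin)
open import Data.List.Relation.Unary.All using (All)
open import Data.List.Relation.Unary.Any using (any?)
open import Data.List.Membership.Propositional using (_∈_)
open import Data.List.Relation.Binary.Permutation.Propositional using (_↭_)
open import Data.Product using (_×_)
open import Relation.Binary.PropositionalEquality using (_≡_)
open import Relation.Nullary using (¬_; yes; no)
open import Data.Rational using (ℚ; 0ℚ; _/_; -_) renaming (_+_ to _+ℚ_; _*_ to _*ℚ_)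

-- Rooted trees whose leaves are labelled by vertices of V = Fin n.
-- The set S_i of a node i is the set of leaf labels below it.
data Tree (n : ℕ) : Set where
  leaf : Fin n → Tree n
  node : List (Tree n) → Tree n

mutual
  leaves : ∀ {n} → Tree n → List (Fin n)
  leaves (leaf v) = v ∷ []
  leaves (node ts) = leavesL ts

  leavesL : ∀ {n} → List (Tree n) → List (Fin n)
  leavesL [] = []
  leavesL (t ∷ ts) = leaves t ++ leavesL ts

size : ∀ {n} → Tree n → ℕ
size t = length (leaves t)

sizeL : ∀ {n} → List (Tree n) → ℕ
sizeL ts = length (leavesL ts)

data Subtree {n : ℕ} (s : Tree n) : Tree n → Set where
  here  : Subtree s s
  there : ∀ {t ts} → t ∈ ts → Subtree s t → Subtree s (node ts)

AllNodes : ∀ {n} → (List (Tree n) → Set) → Tree n → Set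
AllNodes {n} P t = ∀ {ts : List (Tree n)} → Subtree (node ts) t → P ts

-- Hierarchical decomposition of V = Fin n: every vertex occurs exactly once
-- as a leaf (so children's sets partition the parent's set, root set is V,
-- leaves are the singletons), and every non-leaf node has at least one child.
HierDecomp : (n : ℕ) → Tree n → Set
HierDecomp n t = (leaves t ↭ allFin n) × AllNodes (λ ts → ¬ (ts ≡ [])) t

WellBalanced : ∀ {n} → Tree n → Set
WellBalanced t = AllNodes (λ ts → All (λ c → 4 * size c ≤ 3 * sizeL ts) ts) t

Binary : ∀ {n} → Tree n → Set
Binary t = AllNodes (λ ts → length ts ≡ 2) t

-- One binarization step applied at a node with children list ts (p > 2 children).
-- w(h) = |S_{j_h}| / |S_i|, where |S_i| = sizeL ts.
data RootStep {n : ℕ} : List (Tree n) → List (Tree n) → Set where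
  caseA : ∀ {ts c rest} → 2 < length ts → ts ↭ c ∷ rest →
          sizeL ts < 4 * size c →
          RootStep ts (c ∷ node rest ∷ [])
  caseB : ∀ {ts A B} → 2 < length ts →
          All (λ c → 4 * size c ≤ sizeL ts) ts →
          ts ↭ A ++ B →
          sizeL ts ≤ 4 * sizeL A → 4 * sizeL A ≤ 3 * sizeL ts →
          sizeL ts ≤ 4 * sizeL B → 4 * sizeL B ≤ 3 * sizeL ts →
          RootStep ts (node A ∷ node B ∷ [])

data Step {n : ℕ} : Tree n → Tree n → Set where
  atRoot : ∀ {ts ts'} → RootStep ts ts' → Step (node ts) (node ts')
  inside : ∀ {xs t t' ys} → Step t t' →
           Step (node (xs ++ t ∷ ys)) (node (xs ++ t' ∷ ys))

-- 1/m as a rational (0 for m = 0; only used for nonempty sets)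
inv : ℕ → ℚ
inv zero = 0ℚ
inv (suc m) = + 1 / suc m

-- d_i(u) with c = βk, for an internal node i = node (ℓ(i) ∷ r(i) ∷ []) of the binary tree
dval : ∀ {n} → ℚ → Tree n → Fin n → ℚ
dval c (node (l ∷ r ∷ [])) u with any? (u ≟_) (leaves l) | any? (u ≟_) (leaves r)
... | yes _ | _     = - (c *ℚ inv (size l))
... | no _  | yes _ = c *ℚ inv (size r)
... | no _  | no _  = 0ℚ
dval c _ u = 0ℚ

dset : ∀ {n} → ℚ → Tree n → List (Fin n) → ℚ
dset c i [] = 0ℚ
dset c i (w ∷ W) = dval c i w +ℚ dset c i W

mutual
  sumInternal : ∀ {n} → (Tree n → ℚ) → Tree n → ℚ
  sumInternal f (leaf _) = 0ℚ
  sumInternal f (node ts) = f (node ts) +ℚ sumInternalL f ts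

  sumInternalL : ∀ {n} → (Tree n → ℚ) → List (Tree n) → ℚ
  sumInternalL f [] = 0ℚ
  sumInternalL f (t ∷ ts) = sumInternal f t +ℚ sumInternalL f ts

-- Only ancestors of j contribute: for a node i below j, d_i sums to zero on S_i ⊆ S_j and
-- vanishes on the rest of S_j, and a node disjoint from S_j sees none of its vertices. An
-- ancestor whose child towards j is t contributes βk|S_j|/|S_t|. On the path from the root to j,
-- binarization keeps a shrinking factor 3/4 on every edge out of a node of R and on every edge
-- into a created node; the remaining edges go from a created node into a node of R and are
-- followed by a shrinking edge. So the terms decay geometrically every second step, and a
-- potential with weights 8 (nodes of R) and 7 (created nodes) bounds their sum by 8βk.
module Submission where

open import Defs
open import Data.Nat as ℕ using (ℕ; zero; suc; z≤n; s≤s)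
import Data.Nat.Properties as ℕ
open import Data.Rational using (ℚ)
import Data.Rational.Properties as ℚ
open import Data.List using (List; []; _∷_; _++_; length)
open import Data.List.Properties using (++-assoc; ++-identityʳ; length-++)
open import Data.List.Membership.Propositional using (_∈_; _∉_)
open import Data.List.Membership.Propositional.Properties using (∈-++⁺ˡ; ∈-++⁺ʳ)
open import Data.List.Relation.Unary.All as All using (All; []; _∷_)
import Data.List.Relation.Unary.All.Properties as All
open import Data.List.Relation.Unary.Any using (here; there)
open import Data.List.Relation.Unary.AllPairs using ([]; _∷_)
open import Data.List.Relation.Unary.Unique.Propositional using (Unique)
open import Data.List.Relation.Unary.Unique.Propositional.Properties using (allFin⁺)
open import Data.List.Relation.Binary.Disjoint.Propositional using (Disjoint)
open import Data.List.Relation.Binary.Subset.Propositional using (_⊆_)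
open import Data.List.Relation.Binary.Permutation.Propositional
  using (_↭_; ↭-refl; ↭-sym; ↭-trans; ↭-reflexive)
open import Data.List.Relation.Binary.Permutation.Propositional.Properties
  using (All-resp-↭; ↭-length; ++⁺ˡ; shifts; zoom)
open import Data.Product using (Σ; ∃₂; _×_; _,_; proj₁; proj₂; swap)
open import Data.Unit using (⊤; tt)
open import Function using (id; _∘_)
open import Relation.Unary using (Pred)
open import Relation.Nullary using (¬_; yes; no)
open import Data.Empty using (⊥-elim)
open import Data.Fin using (Fin)
open import Relation.Binary.PropositionalEquality
open import Relation.Binary.Construct.Closure.ReflexiveTransitive using (Star; ε; _◅_)
open import Algebra.Bundles using (Ring)
open import Algebra.Properties.Semiring.Mult (Ring.semiring ℚ.+-*-ring)
  using (×-assocˡ; ×-assoc-*; ×-comm-*) renaming (_×_ to _·_)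

module _ {a} {A : Set a} where

  Unique-++⁻ : ∀ xs {ys : List A} → Unique (xs ++ ys) → Unique xs × Unique ys × Disjoint xs ys
  Unique-++⁻ [] u = [] , u , λ ()
  Unique-++⁻ (x ∷ xs) {ys} (x∉ ∷ u) with Unique-++⁻ xs u
  ... | uxs , uys , xs#ys = All.++⁻ˡ xs x∉ ∷ uxs , uys , disjoint
    where
    disjoint : Disjoint (x ∷ xs) ys
    disjoint (here refl , y∈ys) = All.lookup x∉ (∈-++⁺ʳ xs y∈ys) refl
    disjoint (there y∈xs , y∈ys) = xs#ys (y∈xs , y∈ys)

  Unique-resp-↭ : {xs ys : List A} → xs ↭ ys → Unique xs → Unique ys
  Unique-resp-↭ _↭_.refl u = u
  Unique-resp-↭ (_↭_.prep x p) (x∉ ∷ u) = All-resp-↭ p x∉ ∷ Unique-resp-↭ p u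
  Unique-resp-↭ (_↭_.swap x y p) ((x≢y ∷ x∉) ∷ y∉ ∷ u) =
    ((x≢y ∘ sym) ∷ All-resp-↭ p y∉) ∷ All-resp-↭ p x∉ ∷ Unique-resp-↭ p u
  Unique-resp-↭ (_↭_.trans p q) u = Unique-resp-↭ q (Unique-resp-↭ p u)

  All-replace : ∀ {p q} {P : Pred A p} {Q : Pred A q} (xs : List A) {t t′ : A} {ys : List A} →
                (∀ {x} → P x → Q x) → (P t → Q t′) →
                All P (xs ++ t ∷ ys) → All Q (xs ++ t′ ∷ ys)
  All-replace [] f g (pt ∷ pys) = g pt ∷ All.map f pys
  All-replace (x ∷ xs) f g (px ∷ pxs) = f px ∷ All-replace xs f g pxs

data Kind : Set where
  balanced inserted : Kind

module _ where

  open import Data.Nat using (_≤_; _<_; _+_; _*_)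

  Shrinks : ℕ → ℕ → Set
  Shrinks m S = 4 * m ≤ 3 * S

  complement-shrinks : ∀ a b → a + b < 4 * a → Shrinks b (a + b)
  complement-shrinks a b h = subst (4 * b ≤_) (sym (ℕ.*-distribˡ-+ 3 a b))
    (ℕ.+-monoˡ-≤ (3 * b) (ℕ.<⇒≤ (ℕ.+-cancelˡ-< a b (3 * a) h)))

  -- Splitting on the child kind first makes EdgeBound κ inserted reduce for every κ.
  EdgeBound : Kind → Kind → ℕ → ℕ → Set
  EdgeBound _        inserted = Shrinks
  EdgeBound balanced balanced = Shrinks
  EdgeBound inserted balanced = λ _ _ → ⊤

  weight : Kind → ℕ
  weight balanced = 8
  weight inserted = 7

  weight≤8 : ∀ κ → weight κ ≤ 8
  weight≤8 balanced = ℕ.≤-refl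
  weight≤8 inserted = ℕ.n≤1+n 7

module _ {n : ℕ} where

  open import Data.Nat using (_≤_; _<_; _+_; _*_)

  leavesL-++ : (xs ys : List (Tree n)) → leavesL (xs ++ ys) ≡ leavesL xs ++ leavesL ys
  leavesL-++ [] ys = refl
  leavesL-++ (x ∷ xs) ys =
    trans (cong (leaves x ++_) (leavesL-++ xs ys)) (sym (++-assoc (leaves x) (leavesL xs) (leavesL ys)))

  leavesL-↭ : {xs ys : List (Tree n)} → xs ↭ ys → leavesL xs ↭ leavesL ys
  leavesL-↭ _↭_.refl = ↭-refl
  leavesL-↭ (_↭_.prep x p) = ++⁺ˡ (leaves x) (leavesL-↭ p)
  leavesL-↭ (_↭_.swap x y p) =
    ↭-trans (shifts (leaves x) (leaves y)) (++⁺ˡ (leaves y) (++⁺ˡ (leaves x) (leavesL-↭ p)))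
  leavesL-↭ (_↭_.trans p q) = ↭-trans (leavesL-↭ p) (leavesL-↭ q)

  leavesL-split : ∀ {t : Tree n} {ts} → t ∈ ts → ∃₂ λ P Q → leavesL ts ≡ P ++ leaves t ++ Q
  leavesL-split {ts = t ∷ ts} (here refl) = [] , leavesL ts , refl
  leavesL-split {ts = u ∷ ts} (there t∈) with leavesL-split t∈
  ... | P , Q , eq = leaves u ++ P , Q , trans (cong (leaves u ++_) eq) (sym (++-assoc (leaves u) P _))

  Subtree-split : ∀ {s t : Tree n} → Subtree s t → ∃₂ λ P Q → leaves t ≡ P ++ leaves s ++ Q
  Subtree-split here = [] , [] , sym (++-identityʳ _)
  Subtree-split {s} (there {t} {ts} t∈ sub) with leavesL-split t∈ | Subtree-split sub
  ... | P , Q , eq | P′ , Q′ , eq′ = P ++ P′ , Q′ ++ Q , (begin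
    leavesL ts                          ≡⟨ eq ⟩
    P ++ leaves t ++ Q                  ≡⟨ cong (λ L → P ++ L ++ Q) eq′ ⟩
    P ++ (P′ ++ leaves s ++ Q′) ++ Q    ≡⟨ cong (P ++_) (++-assoc P′ _ Q) ⟩
    P ++ P′ ++ (leaves s ++ Q′) ++ Q    ≡⟨ cong (λ L → P ++ P′ ++ L) (++-assoc (leaves s) Q′ Q) ⟩
    P ++ P′ ++ leaves s ++ Q′ ++ Q      ≡⟨ sym (++-assoc P P′ _) ⟩
    (P ++ P′) ++ leaves s ++ Q′ ++ Q    ∎)
    where open ≡-Reasoning

  Subtree-⊆ : ∀ {s t : Tree n} → Subtree s t → leaves s ⊆ leaves t
  Subtree-⊆ sub w∈ with Subtree-split sub
  ... | P , Q , eq = subst (_ ∈_) (sym eq) (∈-++⁺ʳ P (∈-++⁺ˡ w∈))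

  Unique-Subtree : ∀ {s t : Tree n} → Subtree s t → Unique (leaves t) → Unique (leaves s)
  Unique-Subtree {s} sub u with Subtree-split sub
  ... | P , Q , eq = proj₁ (Unique-++⁻ (leaves s) (proj₁ (proj₂ (Unique-++⁻ P (subst Unique eq u)))))

  size-∈ : ∀ {t : Tree n} {ts} → t ∈ ts → size t ≤ sizeL ts
  size-∈ {t} {t ∷ ts} (here refl) = subst (size t ≤_) (sym (length-++ (leaves t))) (ℕ.m≤m+n _ (sizeL ts))
  size-∈ {ts = u ∷ ts} (there t∈) =
    ℕ.≤-trans (size-∈ t∈) (subst (sizeL ts ≤_) (sym (length-++ (leaves u))) (ℕ.m≤n+m _ _))

  data IsBinary : Tree n → Set where
    leaf : ∀ {v} → IsBinary (leaf v)
    node : ∀ {l r} → IsBinary l → IsBinary r → IsBinary (node (l ∷ r ∷ []))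

  Binary⇒IsBinary : ∀ t → Binary t → IsBinary t
  Binary⇒IsBinary (leaf _) _ = leaf
  Binary⇒IsBinary (node []) b with b here
  ... | ()
  Binary⇒IsBinary (node (_ ∷ [])) b with b here
  ... | ()
  Binary⇒IsBinary (node (l ∷ r ∷ [])) b =
    node (Binary⇒IsBinary l (b ∘ there (here refl))) (Binary⇒IsBinary r (b ∘ there (there (here refl))))
  Binary⇒IsBinary (node (_ ∷ _ ∷ _ ∷ _)) b with b here
  ... | ()

  IsBinary-Subtree : ∀ {s t : Tree n} → Subtree s t → IsBinary t → IsBinary s
  IsBinary-Subtree here b = b
  IsBinary-Subtree (there (here refl) sub) (node bl _) = IsBinary-Subtree sub bl
  IsBinary-Subtree (there (there (here refl)) sub) (node _ br) = IsBinary-Subtree sub br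

  size≥1 : ∀ {t : Tree n} → IsBinary t → 1 ≤ size t
  size≥1 leaf = s≤s z≤n
  size≥1 (node {l} {r} bl _) = ℕ.≤-trans (size≥1 bl) (size-∈ {l} {l ∷ r ∷ []} (here refl))

  -- The invariant kept by binarization. Nodes of R (also after a step of case (a)) are balanced:
  -- every child has at most 3/4 of their size. The nodes created by a step are inserted: every
  -- child is balanced, or inserted with at most 3/4 of their size. A node with more than two
  -- children has only balanced children, which is what a step at that node needs.
  mutual
    data Inv : Kind → Tree n → Set where
      leaf : ∀ {v} → Inv balanced (leaf v)
      node : ∀ {κ ts} → All (Child κ (sizeL ts)) ts →
             (2 < length ts → All (Inv balanced) ts) → Inv κ (node ts)

    Child : Kind → ℕ → Tree n → Set
    Child κ S c = Σ Kind λ κ′ → Inv κ′ c × EdgeBound κ κ′ (size c) S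

  Child-map : ∀ κ {S S′} {c c′ : Tree n} → S ≡ S′ → size c ≡ size c′ →
              (∀ {κ′} → Inv κ′ c → Inv κ′ c′) → Child κ S c → Child κ S′ c′
  Child-map κ S≡ c≡ f (κ′ , inv , bound) = κ′ , f inv , subst₂ (EdgeBound κ κ′) c≡ S≡ bound

  inserted-child : ∀ κ {S} {xs : List (Tree n)} → All (Inv balanced) xs → Shrinks (sizeL xs) S →
                   Child κ S (node xs)
  inserted-child κ bal shrinks =
    inserted , node (All.map (λ inv → balanced , inv , tt) bal) (λ _ → bal) , shrinks

  RootStep-leaves : ∀ {ts ts′ : List (Tree n)} → RootStep ts ts′ → leavesL ts ↭ leavesL ts′
  RootStep-leaves (caseA {c = c} _ p _) =
    ↭-trans (leavesL-↭ p) (↭-reflexive (cong (leaves c ++_) (sym (++-identityʳ _))))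
  RootStep-leaves (caseB {A = A} {B} _ _ p _ _ _ _) =
    ↭-trans (leavesL-↭ p) (↭-reflexive (trans (leavesL-++ A B) (cong (leavesL A ++_) (sym (++-identityʳ _)))))

  RootStep-children : ∀ {κ} {ts ts′ : List (Tree n)} → RootStep ts ts′ → All (Inv balanced) ts →
                      All (Child κ (sizeL ts)) ts → All (Child κ (sizeL ts)) ts′
  RootStep-children {κ} {ts} (caseA {c = c} {rest} _ p big) bal children =
    All.head (All-resp-↭ p children) ∷ inserted-child κ (All.tail (All-resp-↭ p bal)) rest-shrinks ∷ []
    where
    sizeL-ts : sizeL ts ≡ size c + sizeL rest
    sizeL-ts = trans (↭-length (leavesL-↭ p)) (length-++ (leaves c))
    rest-shrinks : Shrinks (sizeL rest) (sizeL ts)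
    rest-shrinks = subst (Shrinks (sizeL rest)) (sym sizeL-ts)
      (complement-shrinks (size c) (sizeL rest) (subst (_< 4 * size c) sizeL-ts big))
  RootStep-children {κ} (caseB {A = A} _ _ p _ A-shrinks _ B-shrinks) bal _ =
    let balA , balB = All.++⁻ A (All-resp-↭ p bal) in
    inserted-child κ balA A-shrinks ∷ inserted-child κ balB B-shrinks ∷ []

  Inv-rootStep : ∀ {κ} {ts ts′ : List (Tree n)} → RootStep ts ts′ → Inv κ (node ts) → Inv κ (node ts′)
  Inv-rootStep {κ} st (node children wide) =
    node (subst (λ S → All (Child κ S) _) (↭-length (RootStep-leaves st))
           (RootStep-children st (wide (splits st)) children))
         (⊥-elim ∘ not-wide st)
    where
    splits : ∀ {ts ts′ : List (Tree n)} → RootStep ts ts′ → 2 < length ts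
    splits (caseA wide _ _) = wide
    splits (caseB wide _ _ _ _ _ _) = wide
    not-wide : ∀ {ts ts′ : List (Tree n)} → RootStep ts ts′ → ¬ 2 < length ts′
    not-wide (caseA _ _ _) (s≤s (s≤s ()))
    not-wide (caseB _ _ _ _ _ _ _) (s≤s (s≤s ()))

  Step-leaves : ∀ {t t′ : Tree n} → Step t t′ → leaves t ↭ leaves t′
  Step-leaves (atRoot st) = RootStep-leaves st
  Step-leaves (inside {xs} {ys = ys} s) =
    subst₂ _↭_ (sym (leavesL-++ xs _)) (sym (leavesL-++ xs _)) (zoom (leavesL xs) (Step-leaves s))

  Inv-step : ∀ {κ} {t t′ : Tree n} → Step t t′ → Inv κ t → Inv κ t′
  Inv-step (atRoot st) inv = Inv-rootStep st inv
  Inv-step {κ} (inside {xs} {t} {t′} {ys} s) (node children wide) =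
    node (All-replace xs (Child-map κ sizeL≡ refl id) (Child-map κ sizeL≡ size≡ (Inv-step s)) children)
         (All-replace xs id (Inv-step s) ∘ wide ∘ subst (2 <_) (sym length≡))
    where
    size≡ : size t ≡ size t′
    size≡ = ↭-length (Step-leaves s)
    sizeL≡ : sizeL (xs ++ t ∷ ys) ≡ sizeL (xs ++ t′ ∷ ys)
    sizeL≡ = ↭-length (Step-leaves (inside {xs = xs} {ys = ys} s))
    length≡ : length (xs ++ t ∷ ys) ≡ length (xs ++ t′ ∷ ys)
    length≡ = trans (length-++ xs) (sym (length-++ xs))

  Step*-leaves : ∀ {t t′ : Tree n} → Star Step t t′ → leaves t ↭ leaves t′
  Step*-leaves ε = ↭-refl
  Step*-leaves (s ◅ ss) = ↭-trans (Step-leaves s) (Step*-leaves ss)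

  Inv-step* : ∀ {κ} {t t′ : Tree n} → Star Step t t′ → Inv κ t → Inv κ t′
  Inv-step* ε = id
  Inv-step* (s ◅ ss) = Inv-step* ss ∘ Inv-step s

  mutual
    Inv-wellBalanced : ∀ t → WellBalanced t → Inv balanced t
    Inv-wellBalanced (leaf _) _ = leaf
    Inv-wellBalanced (node ts) wb =
      node (All.zipWith (λ (shrinks , inv) → balanced , inv , shrinks) (wb here , invs)) (λ _ → invs)
      where
      invs : All (Inv balanced) ts
      invs = Inv-wellBalancedL ts (λ t∈ sub → wb (there t∈ sub))

    Inv-wellBalancedL : ∀ ts → (∀ {t} → t ∈ ts → WellBalanced t) → All (Inv balanced) ts
    Inv-wellBalancedL [] _ = []
    Inv-wellBalancedL (t ∷ ts) wb = Inv-wellBalanced t (wb (here refl)) ∷ Inv-wellBalancedL ts (wb ∘ there)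

module _ where

  open import Data.Rational
  open import Data.Rational.Properties
  open import Data.Integer using (+_)
  import Data.Integer as ℤ
  import Data.Nat.Coprimality as Coprime
  import Data.Rational.Unnormalised as ℚᵘ
  import Data.Rational.Unnormalised.Properties as ℚᵘ
  open import Data.Integer.Tactic.RingSolver using (solve-∀)

  ·-nonNeg : ∀ m {q} → 0ℚ ≤ q → 0ℚ ≤ m · q
  ·-nonNeg zero _ = ≤-refl
  ·-nonNeg (suc m) q≥0 = +-mono-≤ q≥0 (·-nonNeg m q≥0)

  ·-monoʳ-≤ : ∀ m {p q} → p ≤ q → m · p ≤ m · q
  ·-monoʳ-≤ zero _ = ≤-refl
  ·-monoʳ-≤ (suc m) p≤q = +-mono-≤ p≤q (·-monoʳ-≤ m p≤q)

  ·-monoˡ-≤ : ∀ {l m} q → l ℕ.≤ m → 0ℚ ≤ q → l · q ≤ m · q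
  ·-monoˡ-≤ {m = m} q z≤n q≥0 = ·-nonNeg m q≥0
  ·-monoˡ-≤ q (s≤s l≤m) q≥0 = +-monoʳ-≤ q (·-monoˡ-≤ q l≤m q≥0)

  ·-comm : ∀ l m q → l · m · q ≡ m · l · q
  ·-comm l m q = trans (×-assocˡ q l m) (trans (cong (_· q) (ℕ.*-comm l m)) (sym (×-assocˡ q m l)))

  /1-suc : ∀ m → + suc m / 1 ≡ 1ℚ + + m / 1
  /1-suc m = toℚᵘ-injective (begin-equality
    toℚᵘ (+ suc m / 1)              ≃⟨ toℚᵘ-fromℚᵘ (ℚᵘ.mkℚᵘ (+ suc m) 0) ⟩
    ℚᵘ.mkℚᵘ (+ suc m) 0            ≃⟨ ℚᵘ.*≡* (suc-identity (+ m)) ⟩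
    ℚᵘ.1ℚᵘ ℚᵘ.+ ℚᵘ.mkℚᵘ (+ m) 0   ≃⟨ ℚᵘ.+-congʳ ℚᵘ.1ℚᵘ (toℚᵘ-fromℚᵘ (ℚᵘ.mkℚᵘ (+ m) 0)) ⟨
    toℚᵘ 1ℚ ℚᵘ.+ toℚᵘ (+ m / 1)    ≃⟨ toℚᵘ-homo-+ 1ℚ (+ m / 1) ⟨
    toℚᵘ (1ℚ + + m / 1)            ∎)
    where
    open ℚᵘ.≤-Reasoning
    suc-identity : ∀ x → (+ 1 ℤ.+ x) ℤ.* + 1 ≡ (+ 1 ℤ.* + 1 ℤ.+ x ℤ.* + 1) ℤ.* + 1
    suc-identity = solve-∀

  ·-one : ∀ m → m · 1ℚ ≡ + m / 1
  ·-one zero = refl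
  ·-one (suc m) = trans (cong (_+_ 1ℚ) (·-one m)) (sym (/1-suc m))

  ·≡* : ∀ m q → m · q ≡ + m / 1 * q
  ·≡* m q = begin
    m · q              ≡⟨ cong (m ·_) (*-identityˡ q) ⟨
    m · (1ℚ * q)       ≡⟨ ×-assoc-* m 1ℚ q ⟨
    (m · 1ℚ) * q       ≡⟨ cong (_* q) (·-one m) ⟩
    + m / 1 * q        ∎
    where open ≡-Reasoning

  ·-neg : ∀ m q → m · (- q) ≡ - (m · q)
  ·-neg m q = begin
    m · (- q)           ≡⟨ ·≡* m (- q) ⟩
    + m / 1 * - q       ≡⟨ neg-distribʳ-* (+ m / 1) q ⟨
    - (+ m / 1 * q)     ≡⟨ cong -_ (·≡* m q) ⟨
    - (m · q)           ∎
    where open ≡-Reasoning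

  ·-cancelˡ-≤ : ∀ m {p q} → suc m · p ≤ suc m · q → p ≤ q
  ·-cancelˡ-≤ m {p} {q} le =
    *-cancelˡ-≤-pos (+ suc m / 1) {{normalize-pos (suc m) 1}} (subst₂ _≤_ (·≡* (suc m) p) (·≡* (suc m) q) le)

  ·-inv : ∀ m → m ℕ.≥ 1 → m · inv m ≡ 1ℚ
  ·-inv (suc m) _ = begin
    suc m · inv (suc m)             ≡⟨ ·≡* (suc m) _ ⟩
    + suc m / 1 * inv (suc m)       ≡⟨ cong₂ _*_ (fromℚᵘ-toℚᵘ m+1) (fromℚᵘ-toℚᵘ (1/ m+1)) ⟩
    m+1 * 1/ m+1                    ≡⟨ *-inverseʳ m+1 ⟩
    1ℚ                              ∎
    where
    open ≡-Reasoning
    m+1 : ℚ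
    m+1 = mkℚ (+ suc m) 0 (Coprime.sym (Coprime.1-coprimeTo (suc m)))

  0≤/1 : ∀ m → 0ℚ ≤ + m / 1
  0≤/1 m = nonNegative⁻¹ _ {{normalize-nonNeg m 1}}

  0≤inv : ∀ m → 0ℚ ≤ inv m
  0≤inv zero = ≤-refl
  0≤inv (suc m) = nonNegative⁻¹ _ {{normalize-nonNeg 1 (suc m)}}

  *-nonNeg : ∀ {p q} → 0ℚ ≤ p → 0ℚ ≤ q → 0ℚ ≤ p * q
  *-nonNeg {p} {q} p≥0 q≥0 =
    nonNegative⁻¹ _ {{nonNeg*nonNeg⇒nonNeg p {{nonNegative p≥0}} q {{nonNegative q≥0}}}}

  p≤p+q : ∀ p {q} → 0ℚ ≤ q → p ≤ p + q
  p≤p+q p {q} q≥0 = subst (_≤ p + q) (+-identityʳ p) (+-monoʳ-≤ p q≥0)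

  nonNeg-inverse : ∀ {p q} → p * q ≡ 1ℚ → 0ℚ ≤ q → 0ℚ ≤ p
  nonNeg-inverse {p} {q} pq≡1 q≥0 with 0ℚ ≤? p
  ... | yes p≥0 = p≥0
  ... | no p≱0 = ⊥-elim (<-irrefl refl (<-≤-trans (positive⁻¹ 1ℚ) 1≤0))
    where
    1≤0 : 1ℚ ≤ 0ℚ
    1≤0 = subst₂ _≤_ pq≡1 (*-zeroˡ q)
      (*-monoʳ-≤-nonNeg q {{nonNegative q≥0}} (<⇒≤ (≰⇒> p≱0)))

module _ {n : ℕ} (f : Tree n → ℚ) where

  open import Data.Rational using (0ℚ; _+_)

  mutual
    sumInternal-zero : ∀ t → (∀ {ts} → Subtree (node ts) t → f (node ts) ≡ 0ℚ) → sumInternal f t ≡ 0ℚ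
    sumInternal-zero (leaf _) _ = refl
    sumInternal-zero (node ts) f≡0 =
      cong₂ _+_ (f≡0 here) (sumInternalL-zero ts λ t∈ sub → f≡0 (there t∈ sub))

    sumInternalL-zero : ∀ ts → (∀ {t ts′} → t ∈ ts → Subtree (node ts′) t → f (node ts′) ≡ 0ℚ) →
                        sumInternalL f ts ≡ 0ℚ
    sumInternalL-zero [] _ = refl
    sumInternalL-zero (t ∷ ts) f≡0 =
      cong₂ _+_ (sumInternal-zero t (f≡0 (here refl))) (sumInternalL-zero ts (f≡0 ∘ there))

module _ {n : ℕ} (c : ℚ) where

  open import Data.Rational
  open import Data.Rational.Properties
  import Data.Fin.Properties as Fin
  open import Data.List.Relation.Unary.Any using (any?)

  share : ℕ → ℚ
  share m = c * inv m

  ·-share : ∀ m → m ℕ.≥ 1 → m · share m ≡ c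
  ·-share m m≥1 = trans (sym (×-comm-* m c (inv m))) (trans (cong (c *_) (·-inv m m≥1)) (*-identityʳ c))

  module _ (l r : Tree n) {w : Fin n} where

    dval-left : w ∈ leaves l → dval c (node (l ∷ r ∷ [])) w ≡ - share (size l)
    dval-left w∈l with any? (w Fin.≟_) (leaves l)
    ... | yes _ = refl
    ... | no w∉l = ⊥-elim (w∉l w∈l)

    dval-right : w ∉ leaves l → w ∈ leaves r → dval c (node (l ∷ r ∷ [])) w ≡ share (size r)
    dval-right w∉l w∈r with any? (w Fin.≟_) (leaves l) | any? (w Fin.≟_) (leaves r)
    ... | yes w∈l | _ = ⊥-elim (w∉l w∈l)
    ... | no _ | yes _ = refl
    ... | no _ | no w∉r = ⊥-elim (w∉r w∈r)

  dval-outside : ∀ (i : Tree n) {w} → w ∉ leaves i → dval c i w ≡ 0ℚ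
  dval-outside (leaf _) _ = refl
  dval-outside (node []) _ = refl
  dval-outside (node (_ ∷ [])) _ = refl
  dval-outside (node (l ∷ r ∷ [])) {w} w∉i with any? (w Fin.≟_) (leaves l) | any? (w Fin.≟_) (leaves r)
  ... | yes w∈l | _ = ⊥-elim (w∉i (∈-++⁺ˡ w∈l))
  ... | no _ | yes w∈r = ⊥-elim (w∉i (∈-++⁺ʳ (leaves l) (∈-++⁺ˡ w∈r)))
  ... | no _ | no _ = refl
  dval-outside (node (_ ∷ _ ∷ _ ∷ _)) _ = refl

  dset-++ : ∀ (i : Tree n) X Y → dset c i (X ++ Y) ≡ dset c i X + dset c i Y
  dset-++ i [] Y = sym (+-identityˡ _)
  dset-++ i (x ∷ X) Y = trans (cong (_+_ (dval c i x)) (dset-++ i X Y)) (sym (+-assoc (dval c i x) _ _))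

  dset-const : ∀ (i : Tree n) {q} X → All (λ w → dval c i w ≡ q) X → dset c i X ≡ length X · q
  dset-const i [] [] = refl
  dset-const i (x ∷ X) (eq ∷ eqs) = cong₂ _+_ eq (dset-const i X eqs)

  dset-outside : ∀ (i : Tree n) X → All (_∉ leaves i) X → dset c i X ≡ 0ℚ
  dset-outside i [] [] = refl
  dset-outside i (x ∷ X) (x∉ ∷ X∉) = cong₂ _+_ (dval-outside i x∉) (dset-outside i X X∉)

  dset-self : ∀ {i : Tree n} → IsBinary i → Unique (leaves i) → dset c i (leaves i) ≡ 0ℚ
  dset-self leaf _ = refl
  dset-self {i} (node {l} {r} bl br) u = begin
    dset c i (leaves l ++ leaves r ++ [])             ≡⟨ dset-++ i (leaves l) _ ⟩
    dset c i (leaves l) + dset c i (leaves r ++ [])   ≡⟨ cong₂ _+_ left right ⟩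
    - c + c                                           ≡⟨ +-inverseˡ c ⟩
    0ℚ                                                ∎
    where
    open ≡-Reasoning
    l#r : Disjoint (leaves l) (leaves r ++ [])
    l#r = proj₂ (proj₂ (Unique-++⁻ (leaves l) u))
    left : dset c i (leaves l) ≡ - c
    left = begin
      dset c i (leaves l)           ≡⟨ dset-const i (leaves l) (All.tabulate (dval-left l r)) ⟩
      size l · - share (size l)     ≡⟨ ·-neg (size l) _ ⟩
      - (size l · share (size l))   ≡⟨ cong -_ (·-share (size l) (size≥1 bl)) ⟩
      - c                           ∎
    right : dset c i (leaves r ++ []) ≡ c
    right = begin
      dset c i (leaves r ++ [])     ≡⟨ cong (dset c i) (++-identityʳ (leaves r)) ⟩
      dset c i (leaves r)           ≡⟨ dset-const i (leaves r) (All.tabulate λ w∈r →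
                                         dval-right l r (λ w∈l → l#r (w∈l , ∈-++⁺ˡ w∈r)) w∈r) ⟩
      size r · share (size r)       ≡⟨ ·-share (size r) (size≥1 br) ⟩
      c                             ∎

  dset-block : ∀ {i : Tree n} P Q → IsBinary i → Unique (P ++ leaves i ++ Q) →
               dset c i (P ++ leaves i ++ Q) ≡ 0ℚ
  dset-block {i} P Q b u =
    let _ , uIQ , P#IQ = Unique-++⁻ P u
        uI , _ , I#Q = Unique-++⁻ (leaves i) uIQ
        P-zero = dset-outside i P (All.tabulate λ w∈P w∈i → P#IQ (w∈P , ∈-++⁺ˡ w∈i))
        Q-zero = dset-outside i Q (All.tabulate λ w∈Q w∈i → I#Q (w∈i , w∈Q))
    in trans (dset-++ i P _)
             (cong₂ _+_ P-zero (trans (dset-++ i (leaves i) Q) (cong₂ _+_ (dset-self b uI) Q-zero)))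

  module _ (c≥0 : 0ℚ ≤ c) (j : Tree n) where

    demand : Tree n → ℚ
    demand i = ∣ dset c i (leaves j) ∣

    -- |d_i(S_j)| for an ancestor i of j whose child towards j has m leaves.
    pathDemand : ℕ → ℚ
    pathDemand m = size j · share m

    pathDemand-nonNeg : ∀ m → 0ℚ ≤ pathDemand m
    pathDemand-nonNeg m = ·-nonNeg (size j) (*-nonNeg c≥0 (0≤inv m))

    ·-pathDemand : ∀ m → m ℕ.≥ 1 → m · pathDemand m ≡ size j · c
    ·-pathDemand m m≥1 = trans (·-comm m (size j) (share m)) (cong (size j ·_) (·-share m m≥1))

    pathDemand-ratio : ∀ a b {m S} → m ℕ.≥ 1 → S ℕ.≥ 1 → a ℕ.* m ℕ.≤ b ℕ.* S →
                       a · pathDemand S ≤ b · pathDemand m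
    pathDemand-ratio a b {suc m} {S} m≥1 S≥1 am≤bS = ·-cancelˡ-≤ m (begin
      suc m · a · pathDemand S          ≡⟨ ·-comm (suc m) a _ ⟩
      a · suc m · pathDemand S          ≡⟨ ×-assocˡ _ a (suc m) ⟩
      (a ℕ.* suc m) · pathDemand S      ≤⟨ ·-monoˡ-≤ _ am≤bS (pathDemand-nonNeg S) ⟩
      (b ℕ.* S) · pathDemand S          ≡⟨ ×-assocˡ _ b S ⟨
      b · S · pathDemand S              ≡⟨ cong (b ·_) (·-pathDemand S S≥1) ⟩
      b · size j · c                    ≡⟨ cong (b ·_) (·-pathDemand (suc m) m≥1) ⟨
      b · suc m · pathDemand (suc m)    ≡⟨ ·-comm b (suc m) _ ⟩
      suc m · b · pathDemand (suc m)    ∎)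
      where open ≤-Reasoning

    pathDemand-shrinks : ∀ {m S} → m ℕ.≥ 1 → S ℕ.≥ 1 → Shrinks m S →
                         8 · pathDemand S ≤ 6 · pathDemand m
    pathDemand-shrinks {m} {S} m≥1 S≥1 shrinks =
      subst₂ _≤_ (×-assocˡ (pathDemand S) 2 4) (×-assocˡ (pathDemand m) 2 3)
        (·-monoʳ-≤ 2 (pathDemand-ratio 4 3 m≥1 S≥1 shrinks))

    edge-decrease : ∀ κ κ′ {m S} → m ℕ.≥ 1 → S ℕ.≥ 1 → m ℕ.≤ S → EdgeBound κ κ′ m S →
                    pathDemand m + weight κ · pathDemand S ≤ weight κ′ · pathDemand m
    edge-decrease balanced balanced {m} m≥1 S≥1 _ shrinks = +-monoʳ-≤ (pathDemand m)
      (≤-trans (pathDemand-shrinks m≥1 S≥1 shrinks) (·-monoˡ-≤ _ (ℕ.n≤1+n 6) (pathDemand-nonNeg m)))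
    edge-decrease balanced inserted {m} m≥1 S≥1 _ shrinks = +-monoʳ-≤ (pathDemand m)
      (pathDemand-shrinks m≥1 S≥1 shrinks)
    edge-decrease inserted balanced {m} m≥1 S≥1 m≤S _ = +-monoʳ-≤ (pathDemand m)
      (pathDemand-ratio 7 7 m≥1 S≥1 (ℕ.*-monoʳ-≤ 7 m≤S))
    edge-decrease inserted inserted {m} {S} m≥1 S≥1 _ shrinks = +-monoʳ-≤ (pathDemand m)
      (≤-trans (·-monoˡ-≤ _ (ℕ.n≤1+n 7) (pathDemand-nonNeg S)) (pathDemand-shrinks m≥1 S≥1 shrinks))

    sumInternal-disjoint : ∀ t → Disjoint (leaves j) (leaves t) → sumInternal demand t ≡ 0ℚ
    sumInternal-disjoint t j#t = sumInternal-zero demand t λ {ts} sub →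
      cong ∣_∣ (dset-outside (node ts) (leaves j) (All.tabulate λ w∈j w∈i → j#t (w∈j , Subtree-⊆ sub w∈i)))

    sumInternal-within : IsBinary j → Unique (leaves j) → sumInternal demand j ≡ 0ℚ
    sumInternal-within b u = sumInternal-zero demand j λ {ts} sub →
      let P , Q , eq = Subtree-split sub
      in cong ∣_∣ (trans (cong (dset c (node ts)) eq)
                          (dset-block P Q (IsBinary-Subtree sub b) (subst Unique eq u)))

    demand-left : ∀ l r → leaves j ⊆ leaves l → demand (node (l ∷ r ∷ [])) ≡ pathDemand (size l)
    demand-left l r j⊆l = begin
      ∣ dset c (node (l ∷ r ∷ [])) (leaves j) ∣   ≡⟨ cong ∣_∣ (dset-const _ (leaves j)
                                                       (All.tabulate (dval-left l r ∘ j⊆l))) ⟩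
      ∣ size j · - share (size l) ∣              ≡⟨ cong ∣_∣ (·-neg (size j) _) ⟩
      ∣ - pathDemand (size l) ∣                  ≡⟨ ∣-p∣≡∣p∣ _ ⟩
      ∣ pathDemand (size l) ∣                    ≡⟨ 0≤p⇒∣p∣≡p (pathDemand-nonNeg (size l)) ⟩
      pathDemand (size l)                        ∎
      where open ≡-Reasoning

    demand-right : ∀ l r → leaves j ⊆ leaves r → Disjoint (leaves l) (leaves j) →
                   demand (node (l ∷ r ∷ [])) ≡ pathDemand (size r)
    demand-right l r j⊆r l#j = begin
      ∣ dset c (node (l ∷ r ∷ [])) (leaves j) ∣   ≡⟨ cong ∣_∣ (dset-const _ (leaves j) (All.tabulate λ w∈j →
                                                       dval-right l r (λ w∈l → l#j (w∈l , w∈j)) (j⊆r w∈j))) ⟩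
      ∣ pathDemand (size r) ∣                    ≡⟨ 0≤p⇒∣p∣≡p (pathDemand-nonNeg (size r)) ⟩
      pathDemand (size r)                        ∎
      where open ≡-Reasoning

    sumInternal-path : ∀ {l r t} → t ∈ l ∷ r ∷ [] → Subtree j t → Unique (leaves (node (l ∷ r ∷ []))) →
                       sumInternal demand (node (l ∷ r ∷ [])) ≡ pathDemand (size t) + sumInternal demand t
    sumInternal-path {l} {r} (here refl) sub u = begin
      demand x + (sumInternal demand l + (sumInternal demand r + 0ℚ))
        ≡⟨ cong₂ (λ d s → d + (sumInternal demand l + (s + 0ℚ)))
                 (demand-left l r (Subtree-⊆ sub)) (sumInternal-disjoint r j#r) ⟩
      pathDemand (size l) + (sumInternal demand l + 0ℚ)
        ≡⟨ cong (pathDemand (size l) +_) (+-identityʳ _) ⟩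
      pathDemand (size l) + sumInternal demand l ∎
      where
      open ≡-Reasoning
      x : Tree n
      x = node (l ∷ r ∷ [])
      j#r : Disjoint (leaves j) (leaves r)
      j#r (w∈j , w∈r) = proj₂ (proj₂ (Unique-++⁻ (leaves l) u)) (Subtree-⊆ sub w∈j , ∈-++⁺ˡ w∈r)
    sumInternal-path {l} {r} (there (here refl)) sub u = begin
      demand x + (sumInternal demand l + (sumInternal demand r + 0ℚ))
        ≡⟨ cong₂ (λ d s → d + (s + (sumInternal demand r + 0ℚ)))
                 (demand-right l r (Subtree-⊆ sub) l#j) (sumInternal-disjoint l (l#j ∘ swap)) ⟩
      pathDemand (size r) + (0ℚ + (sumInternal demand r + 0ℚ))
        ≡⟨ cong (pathDemand (size r) +_) (trans (+-identityˡ _) (+-identityʳ _)) ⟩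
      pathDemand (size r) + sumInternal demand r ∎
      where
      open ≡-Reasoning
      x : Tree n
      x = node (l ∷ r ∷ [])
      l#j : Disjoint (leaves l) (leaves j)
      l#j (w∈l , w∈j) = proj₂ (proj₂ (Unique-++⁻ (leaves l) u)) (w∈l , ∈-++⁺ˡ (Subtree-⊆ sub w∈j))

    Potential : Kind → Tree n → Set
    Potential κ x = sumInternal demand x + weight κ · pathDemand (size x) ≤ 8 · c

    path-potential : ∀ {κ x} → Subtree j x → IsBinary x → Unique (leaves x) → Inv κ x → Potential κ x
    path-potential {κ} here b u _ = begin
      sumInternal demand j + weight κ · pathDemand (size j)
        ≡⟨ cong₂ _+_ (sumInternal-within b u) (cong (weight κ ·_) (·-share (size j) (size≥1 b))) ⟩
      0ℚ + weight κ · c                                       ≡⟨ +-identityˡ _ ⟩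
      weight κ · c                                            ≤⟨ ·-monoˡ-≤ c (weight≤8 κ) c≥0 ⟩
      8 · c                                                   ∎
      where open ≤-Reasoning
    path-potential {κ} {x} (there {t} t∈ sub) b@(node _ _) u (node children _) with All.lookup children t∈
    ... | κ′ , inv , bound = begin
      sumInternal demand x + weight κ · pathDemand (size x)
        ≡⟨ cong (_+ weight κ · pathDemand (size x)) (sumInternal-path t∈ sub u) ⟩
      (pathDemand (size t) + sumInternal demand t) + weight κ · pathDemand (size x)
        ≡⟨ cong (_+ weight κ · pathDemand (size x)) (+-comm (pathDemand (size t)) (sumInternal demand t)) ⟩
      (sumInternal demand t + pathDemand (size t)) + weight κ · pathDemand (size x)
        ≡⟨ +-assoc (sumInternal demand t) (pathDemand (size t)) _ ⟩
      sumInternal demand t + (pathDemand (size t) + weight κ · pathDemand (size x))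
        ≤⟨ +-monoʳ-≤ (sumInternal demand t) (edge-decrease κ κ′ (size≥1 bt) (size≥1 b) (size-∈ t∈) bound) ⟩
      sumInternal demand t + weight κ′ · pathDemand (size t)
        ≤⟨ path-potential sub bt (Unique-Subtree (there t∈ here) u) inv ⟩
      8 · c ∎
      where
      open ≤-Reasoning
      bt : IsBinary t
      bt = IsBinary-Subtree (there t∈ here) b

    sumInternal-demand≤ : ∀ {T} → Subtree j T → IsBinary T → Unique (leaves T) → Inv balanced T →
                          sumInternal demand T ≤ 8 · c
    sumInternal-demand≤ {T} sub b u inv =
      ≤-trans (p≤p+q (sumInternal demand T) (·-nonNeg 8 (pathDemand-nonNeg (size T))))
              (path-potential sub b u inv)

open import Data.Nat using (_≤_)
open import Data.Integer using (+_)
open import Data.Rational using (0ℚ; 1ℚ; _/_; ∣_∣) renaming (_≤_ to _≤ℚ_; _*_ to _*ℚ_)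

lemma2 : (n k : ℕ) (α β : ℚ) (R T : Tree n) →
    1 ≤ k → 1ℚ ≤ℚ α → β *ℚ ((+ 8 / 1) *ℚ α) ≡ 1ℚ →
    HierDecomp n R → WellBalanced R →
    Star Step R T → Binary T →
    ∀ (cs : List (Tree n)) → Subtree (node cs) T →
    sumInternal (λ i → ∣ dset (β *ℚ (+ k / 1)) i (leaves (node cs)) ∣) T
      ≤ℚ (+ 8 / 1) *ℚ β *ℚ (+ k / 1)
lemma2 n k α β R T _ 1≤α β8α≡1 (R↭V , _) wb R→T bin cs sub =
  subst (sumInternal (demand c c≥0 (node cs)) T ≤ℚ_) 8·c≡
    (sumInternal-demand≤ c c≥0 (node cs) sub (Binary⇒IsBinary T bin) unique-T
      (Inv-step* R→T (Inv-wellBalanced R wb)))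
  where
  open import Data.Rational.Properties using (≤-trans; *-assoc)
  c : ℚ
  c = β *ℚ (+ k / 1)
  β≥0 : 0ℚ ≤ℚ β
  β≥0 = nonNeg-inverse β8α≡1 (*-nonNeg (0≤/1 8) (≤-trans (0≤/1 1) 1≤α))
  c≥0 : 0ℚ ≤ℚ c
  c≥0 = *-nonNeg β≥0 (0≤/1 k)
  unique-T : Unique (leaves T)
  unique-T = Unique-resp-↭ (↭-trans (↭-sym R↭V) (Step*-leaves R→T)) (allFin⁺ n)
  8·c≡ : 8 · c ≡ (+ 8 / 1) *ℚ β *ℚ (+ k / 1)
  8·c≡ = trans (·≡* 8 c) (sym (*-assoc (+ 8 / 1) β (+ k / 1)))
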